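{- For all $n\geq1$ and $\sigma\in\{231,312\}$, $j_n(\{123,213,\sigma\})=\lceil n/2\rceil$.
   Context: A permutation of a finite set $S$ of positive integers is a word in which each element of $S$ appears exactly once; $\mathfrak{S}_n$ is the set of permutations of $\{1,\dots,n\}$. For a permutation $\pi$ and a letter $x$ of $\pi$, $\rho_\pi(x)$ is the maximal consecutive subword of $\pi$ consisting of the letters immediately to the right of $x$ that are all larger than $x$. $\pi$ is Jacobi if $|\rho_\pi(x)|$ is even for all letters $x$. A permutation $\pi$ avoids a pattern $\sigma$ if no subword of $\pi$ has standardization (relative order) $\sigma$. For a set $\Pi$ of patterns, $j_n(\Pi)$ is the number of Jacobi permutations in $\mathfrak{S}_n$ avoiding every pattern in $\Pi$. -}

module Defs where

open import Data.Nat using (ℕ; zero; suc; _<_; _<ᵇ_)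
open import Data.Bool using (true; false)
open import Data.List using (List; []; _∷_; length; map; upTo; lookup)
open import Data.List.Relation.Binary.Sublist.Propositional using (_⊆_)
open import Data.List.Relation.Binary.Permutation.Propositional using (_↭_)
open import Data.List.Relation.Unary.Unique.Propositional using (Unique)
open import Data.List.Relation.Unary.All using (All)
open import Data.List.Membership.Propositional using (_∈_)
open import Data.Nat.Base using (ℕ)
open import Data.Fin using (Fin; cast)
open import Data.Product using (Σ; ∃; _×_; _,_)
open import Data.Unit using (⊤)
open import Function.Bundles using (_⇔_)
open import Relation.Nullary using (¬_)
open import Relation.Binary.PropositionalEquality using (_≡_)

range : ℕ → List ℕ
range n = map suc (upTo n)

IsPerm : ℕ → List ℕ → Set
IsPerm n π = π ↭ range n

data Even : ℕ → Set where
  even-zero : Even zero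
  even-ss   : ∀ {n} → Even n → Even (suc (suc n))

-- |ρ(x)| for a letter x followed by the word ys: length of the maximal
-- prefix of ys all of whose letters are larger than x
rhoLen : ℕ → List ℕ → ℕ
rhoLen x [] = 0
rhoLen x (y ∷ ys) with x <ᵇ y
... | true  = suc (rhoLen x ys)
... | false = 0

Jacobi : List ℕ → Set
Jacobi [] = ⊤
Jacobi (x ∷ ys) = Even (rhoLen x ys) × Jacobi ys

SameOrder : List ℕ → List ℕ → Set
SameOrder w σ = Σ (length w ≡ length σ) λ eq →
  (i j : Fin (length w)) →
    (lookup w i < lookup w j) ⇔ (lookup σ (cast eq i) < lookup σ (cast eq j))

Contains : List ℕ → List ℕ → Set
Contains π σ = ∃ λ w → (w ⊆ π) × SameOrder w σ

Avoids : List ℕ → List ℕ → Set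
Avoids π σ = ¬ Contains π σ

AvoidsAll : List ℕ → List (List ℕ) → Set
AvoidsAll π Π = All (Avoids π) Π

JacobiAvoider : ℕ → List (List ℕ) → List ℕ → Set
JacobiAvoider n Π π = IsPerm n π × Jacobi π × AvoidsAll π Π

JCount : ℕ → List (List ℕ) → ℕ → Set
JCount n Π k = Σ (List (List ℕ)) λ L →
  Unique L × All (JacobiAvoider n Π) L ×
  (∀ π → JacobiAvoider n Π π → π ∈ L) × length L ≡ k

p123 p213 p231 p312 : List ℕ
p123 = 1 ∷ 2 ∷ 3 ∷ []
p213 = 2 ∷ 1 ∷ 3 ∷ []
p231 = 2 ∷ 3 ∷ 1 ∷ []
p312 = 3 ∷ 1 ∷ 2 ∷ []

{-# OPTIONS --safe #-}
module Submission where

-- 123, 213 and 312 are the three ways of putting a letter in front of a 12, and 123, 213 and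
-- 231 are the three ways of inserting the letter 1 into a 12.  Hence a permutation of [1..n]
-- avoids {123, 213, 312} iff it is k followed by a decreasing word, and avoids
-- {123, 213, 231} iff it is A 1 D with A D decreasing; since a decreasing word is determined
-- by its letters, these are the words k n (n-1) … (k+1) (k-1) … 1 and
-- n (n-1) … (d+2) 1 (d+1) … 2.  In them every letter but k (resp. 1) is followed by a smaller
-- one, and |ρ(k)| = n - k (resp. |ρ(1)| = d).  So the Jacobi ones are those with n - k
-- (resp. d) even, ⌈n/2⌉ in each case.

open import Defs
open import Data.Nat using (ℕ; zero; suc; _+_; _∸_; _<_; _≤_; _≥_; _<ᵇ_; z≤n; s≤s; z<s; s<s; ⌈_/2⌉)
open import Data.Nat.Properties
open import Data.Bool using (true; false)
open import Data.Fin using (zero; suc; #_)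
open import Data.List using (List; []; _∷_; _++_; [_]; length; map; upTo; downFrom; applyDownFrom; reverse)
open import Data.List.Properties
  using (length-map; length-++; length-applyDownFrom; applyDownFrom-∷ʳ; map-downFrom; reverse-upTo;
         ++-identityʳ; ∷-injectiveˡ; ∷-injectiveʳ)
open import Data.List.Membership.Propositional using (_∈_; _∉_)
open import Data.List.Membership.Propositional.Properties using (∈-∃++; ∈-map⁺; ∈-map⁻; ∈-upTo⁺; ∈-upTo⁻)
open import Data.List.Relation.Unary.All as All using (All; []; _∷_)
import Data.List.Relation.Unary.All.Properties as All
open import Data.List.Relation.Unary.Any using (here; there)
open import Data.List.Relation.Unary.AllPairs using (AllPairs; []; _∷_)
import Data.List.Relation.Unary.AllPairs.Properties as AllPairs
open import Data.List.Relation.Unary.Linked.Properties using (AllPairs⇒Linked)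
open import Data.List.Relation.Unary.Sorted.TotalOrder.Properties using (↗↭↗⇒≋)
open import Data.List.Relation.Unary.Unique.Propositional using (Unique)
open import Data.List.Relation.Unary.Unique.Propositional.Properties as Unique using (Unique[x∷xs]⇒x∉xs)
open import Data.List.Relation.Binary.Pointwise using (Pointwise-≡⇒≡)
open import Data.List.Relation.Binary.Sublist.Propositional using (_⊆_; []; _∷_; _∷ʳ_; ⊆-refl; ⊆-trans; to∈; from∈)
open import Data.List.Relation.Binary.Sublist.Propositional.Properties using (∷ˡ⁻)
open import Data.List.Relation.Binary.Permutation.Propositional using (_↭_; ↭-sym; ↭⇒↭ₛ; module PermutationReasoning)
open import Data.List.Relation.Binary.Permutation.Propositional.Properties
  using (↭-reverse; ↭-length; map⁺; shift; ∷↭∷ʳ; drop-mid; ∈-resp-↭; All-resp-↭)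
import Data.List.Relation.Binary.Permutation.Setoid.Properties as SetoidPermutation
open import Data.Product using (∃; ∃₂; _×_; _,_; proj₁; proj₂; -,_)
open import Data.Sum using (_⊎_; inj₁; inj₂)
open import Data.Unit using (tt)
open import Function using (_∘_; const)
open import Function.Bundles using (_⇔_; mk⇔; Equivalence)
open import Relation.Binary.Construct.Flip.EqAndOrd using (totalOrder)
open import Relation.Binary.Definitions using (tri<; tri≈; tri>)
open import Relation.Nullary using (¬_; contradiction)
open import Relation.Binary.PropositionalEquality using (_≡_; _≢_; refl; sym; trans; cong; cong₂; subst; setoid; module ≡-Reasoning)

open Equivalence using (to; from)

-- down lo d = [lo + d, …, lo + 1]
down : ℕ → ℕ → List ℕ
down lo = applyDownFrom (λ i → suc (lo + i))

length-down : ∀ lo d → length (down lo d) ≡ d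
length-down lo = length-applyDownFrom _

down-++ : ∀ lo a b → down (lo + b) a ++ down lo b ≡ down lo (a + b)
down-++ lo zero    b = refl
down-++ lo (suc a) b = cong₂ _∷_ (cong suc lo+b+a≡lo+[a+b]) (down-++ lo a b)
  where
  lo+b+a≡lo+[a+b] : lo + b + a ≡ lo + (a + b)
  lo+b+a≡lo+[a+b] = trans (+-assoc lo b a) (cong (lo +_) (+-comm b a))

down-∷ʳ : ∀ m → down 1 m ++ [ 1 ] ≡ down 0 (suc m)
down-∷ʳ = applyDownFrom-∷ʳ suc

down-> : ∀ lo d → All (lo <_) (down lo d)
down-> lo zero    = []
down-> lo (suc d) = s≤s (m≤m+n lo d) ∷ down-> lo d

down-≤ : ∀ lo d → All (_≤ lo + d) (down lo d)
down-≤ lo zero    = []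
down-≤ lo (suc d) =
  ≤-reflexive (sym (+-suc lo d)) ∷ All.map (λ x≤ → ≤-trans x≤ (+-monoʳ-≤ lo (n≤1+n d))) (down-≤ lo d)

down-nonincreasing : ∀ lo d → AllPairs _≥_ (down lo d)
down-nonincreasing lo zero    = []
down-nonincreasing lo (suc d) = All.map m≤n⇒m≤1+n (down-≤ lo d) ∷ down-nonincreasing lo d

range↭down : ∀ n → range n ↭ down 0 n
range↭down n = begin
  map suc (upTo n)           ↭⟨ map⁺ suc (↭-sym (↭-reverse (upTo n))) ⟩
  map suc (reverse (upTo n)) ≡⟨ cong (map suc) (reverse-upTo n) ⟩
  map suc (downFrom n)       ≡⟨ map-downFrom suc n ⟩
  down 0 n                   ∎
  where open PermutationReasoning

module _ {n π} (π↭ : IsPerm n π) where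

  perm-unique : Unique π
  perm-unique = SetoidPermutation.Unique-resp-↭ (setoid ℕ) (↭⇒↭ₛ (↭-sym π↭))
    (Unique.map⁺ suc-injective (Unique.upTo⁺ n))

  perm-letter : ∀ {x} → x ∈ π → ∃ λ i → i < n × x ≡ suc i
  perm-letter x∈π with i , i∈ , refl ← ∈-map⁻ suc (∈-resp-↭ π↭ x∈π) = i , ∈-upTo⁻ i∈ , refl

  perm-∋1 : n ≥ 1 → 1 ∈ π
  perm-∋1 n≥1 = ∈-resp-↭ (↭-sym π↭) (∈-map⁺ suc (∈-upTo⁺ n≥1))

++-injective : ∀ {A : Set} {xs xs′ ys ys′ : List A} →
  length xs ≡ length xs′ → xs ++ ys ≡ xs′ ++ ys′ → xs ≡ xs′ × ys ≡ ys′
++-injective {xs = []}    {[]}     _   eq = refl , eq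
++-injective {xs = _ ∷ _} {_ ∷ _} len eq =
  let xs≡xs′ , ys≡ys′ = ++-injective (suc-injective len) (∷-injectiveʳ eq)
  in cong₂ _∷_ (∷-injectiveˡ eq) xs≡xs′ , ys≡ys′

++-∷-injectiveʳ : ∀ {A : Set} {x : A} xs xs′ {ys ys′} →
  x ∉ xs → x ∉ xs′ → xs ++ x ∷ ys ≡ xs′ ++ x ∷ ys′ → ys ≡ ys′
++-∷-injectiveʳ []      []       _    _     eq = ∷-injectiveʳ eq
++-∷-injectiveʳ []      (_ ∷ _)  _    x∉xs′ eq = contradiction (here (∷-injectiveˡ eq)) x∉xs′
++-∷-injectiveʳ (_ ∷ _) []       x∉xs _     eq = contradiction (here (sym (∷-injectiveˡ eq))) x∉xs
++-∷-injectiveʳ (_ ∷ xs) (_ ∷ xs′) x∉xs x∉xs′ eq =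
  ++-∷-injectiveʳ xs xs′ (x∉xs ∘ there) (x∉xs′ ∘ there) (∷-injectiveʳ eq)

⊆-insert : ∀ {A : Set} (x : A) xs {ys ws} → ws ⊆ xs ++ ys →
  ∃₂ λ w₁ w₂ → w₁ ++ w₂ ≡ ws × w₁ ++ x ∷ w₂ ⊆ xs ++ x ∷ ys
⊆-insert x []       {ws = ws} s = [] , ws , refl , refl ∷ s
⊆-insert x (z ∷ xs) (_ ∷ʳ s) with w₁ , w₂ , refl , s′ ← ⊆-insert x xs s = w₁ , w₂ , refl , z ∷ʳ s′
⊆-insert x (z ∷ xs) (refl ∷ s) with w₁ , w₂ , refl , s′ ← ⊆-insert x xs s = z ∷ w₁ , w₂ , refl , refl ∷ s′

⊆-remove : ∀ {A : Set} {x : A} xs {ys ws} → All (_≢ x) ws → ws ⊆ xs ++ x ∷ ys → ws ⊆ xs ++ ys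
⊆-remove []       _              (_ ∷ʳ s)   = s
⊆-remove []       (w≢x ∷ _)      (w≡x ∷ _)  = contradiction w≡x w≢x
⊆-remove (z ∷ xs) ws≢x           (_ ∷ʳ s)   = z ∷ʳ ⊆-remove xs ws≢x s
⊆-remove (z ∷ xs) (_ ∷ ws≢x)     (w≡z ∷ s)  = w≡z ∷ ⊆-remove xs ws≢x s

AllPairs-⊆-pair : ∀ {A : Set} {R : A → A → Set} {xs a b} → AllPairs R xs → (a ∷ b ∷ []) ⊆ xs → R a b
AllPairs-⊆-pair (_ ∷ rs) (_ ∷ʳ s)   = AllPairs-⊆-pair rs s
AllPairs-⊆-pair (r ∷ _)  (refl ∷ s) = All.lookup r (to∈ s)

No12 : List ℕ → Set
No12 xs = ∀ {a b} → (a ∷ b ∷ []) ⊆ xs → ¬ a < b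

nonincreasing⇒No12 : ∀ {xs} → AllPairs _≥_ xs → No12 xs
nonincreasing⇒No12 xs≥ s = ≤⇒≯ (AllPairs-⊆-pair xs≥ s)

No12⇒nonincreasing : ∀ {xs} → No12 xs → AllPairs _≥_ xs
No12⇒nonincreasing {[]}     _    = []
No12⇒nonincreasing {x ∷ xs} no12 =
  All.tabulate (λ y∈xs → ≮⇒≥ (no12 (refl ∷ from∈ y∈xs))) ∷ No12⇒nonincreasing (λ s → no12 (x ∷ʳ s))

nonincreasing-↭⇒≡ : ∀ {xs ys} → AllPairs _≥_ xs → AllPairs _≥_ ys → xs ↭ ys → xs ≡ ys
nonincreasing-↭⇒≡ xs≥ ys≥ xs↭ys = Pointwise-≡⇒≡
  (↗↭↗⇒≋ (totalOrder ≤-totalOrder) (AllPairs⇒Linked xs≥) (AllPairs⇒Linked ys≥) (↭⇒↭ₛ xs↭ys))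

rhoLen-< : ∀ {x y ys} → x < y → rhoLen x (y ∷ ys) ≡ suc (rhoLen x ys)
rhoLen-< {x} {y} x<y with x <ᵇ y | <⇒<ᵇ x<y
... | true | _ = refl

rhoLen-≥ : ∀ {x y ys} → y ≤ x → rhoLen x (y ∷ ys) ≡ 0
rhoLen-≥ {x} {y} y≤x with x <ᵇ y | <ᵇ⇒< x y
... | true  | x<y = contradiction (x<y tt) (≤⇒≯ y≤x)
... | false | _   = refl

Even-rhoLen-≥ : ∀ {x y ys} → y ≤ x → Even (rhoLen x (y ∷ ys))
Even-rhoLen-≥ y≤x = subst Even (sym (rhoLen-≥ y≤x)) even-zero

rhoLen-++ : ∀ {x xs ys} → All (x <_) xs → All (_≤ x) ys → rhoLen x (xs ++ ys) ≡ length xs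
rhoLen-++ {ys = []}    []          []         = refl
rhoLen-++ {ys = _ ∷ _} []          (y≤x ∷ _)  = rhoLen-≥ y≤x
rhoLen-++              (x<y ∷ x<xs) ys≤x      = trans (rhoLen-< x<y) (cong suc (rhoLen-++ x<xs ys≤x))

Jacobi-nonincreasing : ∀ {xs} → AllPairs _≥_ xs → Jacobi xs
Jacobi-nonincreasing {[]}        []                  = tt
Jacobi-nonincreasing {_ ∷ []}    (_ ∷ [])            = even-zero , tt
Jacobi-nonincreasing {_ ∷ _ ∷ _} ((y≤x ∷ _) ∷ xs≥)   = Even-rhoLen-≥ y≤x , Jacobi-nonincreasing xs≥

Jacobi-++⁺ : ∀ {xs y ys} → AllPairs _≥_ xs → All (y ≤_) xs → Jacobi (y ∷ ys) → Jacobi (xs ++ y ∷ ys)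
Jacobi-++⁺ {[]}        []                 []          j = j
Jacobi-++⁺ {_ ∷ []}    (_ ∷ [])           (y≤x ∷ [])  j = Even-rhoLen-≥ y≤x , j
Jacobi-++⁺ {_ ∷ _ ∷ _} ((x′≤x ∷ _) ∷ xs≥) (_ ∷ y≤xs)  j = Even-rhoLen-≥ x′≤x , Jacobi-++⁺ xs≥ y≤xs j

Jacobi-++⁻ʳ : ∀ xs {ys} → Jacobi (xs ++ ys) → Jacobi ys
Jacobi-++⁻ʳ []       j       = j
Jacobi-++⁻ʳ (_ ∷ xs) (_ , j) = Jacobi-++⁻ʳ xs j

data Concordant (a b x y : ℕ) : Set where
  both< : a < b → x < y → Concordant a b x y
  both> : b < a → y < x → Concordant a b x y

concordant⇒⇔ : ∀ {a b x y} → Concordant a b x y → (a < b ⇔ x < y)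
concordant⇒⇔ (both< a<b x<y) = mk⇔ (const x<y) (const a<b)
concordant⇒⇔ (both> b<a y<x) = mk⇔ (contradiction b<a ∘ <⇒≯) (contradiction y<x ∘ <⇒≯)

concordant-sym : ∀ {a b x y} → Concordant a b x y → Concordant b a y x
concordant-sym (both< a<b x<y) = both> a<b x<y
concordant-sym (both> b<a y<x) = both< b<a y<x

irrefl⇔ : ∀ {a x} → (a < a ⇔ x < x)
irrefl⇔ = mk⇔ (λ a<a → contradiction a<a (<-irrefl refl)) (λ x<x → contradiction x<x (<-irrefl refl))

sameOrder-triple : ∀ {a b c x y z} → Concordant a b x y → Concordant a c x z → Concordant b c y z →
  SameOrder (a ∷ b ∷ c ∷ []) (x ∷ y ∷ z ∷ [])
sameOrder-triple ab ac bc = refl , λ where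
  zero             zero             → irrefl⇔
  zero             (suc zero)       → concordant⇒⇔ ab
  zero             (suc (suc zero)) → concordant⇒⇔ ac
  (suc zero)       zero             → concordant⇒⇔ (concordant-sym ab)
  (suc zero)       (suc zero)       → irrefl⇔
  (suc zero)       (suc (suc zero)) → concordant⇒⇔ bc
  (suc (suc zero)) zero             → concordant⇒⇔ (concordant-sym ac)
  (suc (suc zero)) (suc zero)       → concordant⇒⇔ (concordant-sym bc)
  (suc (suc zero)) (suc (suc zero)) → irrefl⇔

occurrence : ∀ {π x y z} → Contains π (x ∷ y ∷ z ∷ []) →
  ∃₂ λ a b → ∃ λ c → (a ∷ b ∷ c ∷ []) ⊆ π × SameOrder (a ∷ b ∷ c ∷ []) (x ∷ y ∷ z ∷ [])
occurrence (_ ∷ _ ∷ _ ∷ [] , s , so)   = -, -, -, s , so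
occurrence ([] , _ , () , _)
occurrence (_ ∷ [] , _ , () , _)
occurrence (_ ∷ _ ∷ [] , _ , () , _)
occurrence (_ ∷ _ ∷ _ ∷ _ ∷ _ , _ , () , _)

module _ {π : List ℕ} {a b c : ℕ} (s : (a ∷ b ∷ c ∷ []) ⊆ π) where

  contains123 : a < b → b < c → Contains π p123
  contains123 a<b b<c = -, s , sameOrder-triple
    (both< a<b (s<s z<s)) (both< (<-trans a<b b<c) (s<s z<s)) (both< b<c (s<s (s<s z<s)))

  contains213 : b < a → a < c → Contains π p213
  contains213 b<a a<c = -, s , sameOrder-triple
    (both> b<a (s<s z<s)) (both< a<c (s<s (s<s z<s))) (both< (<-trans b<a a<c) (s<s z<s))

  contains231 : a < b → c < a → Contains π p231
  contains231 a<b c<a = -, s , sameOrder-triple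
    (both< a<b (s<s (s<s z<s))) (both> c<a (s<s z<s)) (both> (<-trans c<a a<b) (s<s z<s))

  contains312 : b < c → c < a → Contains π p312
  contains312 b<c c<a = -, s , sameOrder-triple
    (both> (<-trans b<c c<a) (s<s z<s)) (both> c<a (s<s (s<s z<s))) (both< b<c (s<s z<s))

Π312 Π231 : List (List ℕ)
Π312 = p123 ∷ p213 ∷ p312 ∷ []
Π231 = p123 ∷ p213 ∷ p231 ∷ []

No12⇒avoidsΠ312 : ∀ {k q} → No12 q → AvoidsAll (k ∷ q) Π312
No12⇒avoidsΠ312 {k} {q} no12 = endsIn12 (s<s (s<s z<s)) ∷ endsIn12 (s<s z<s) ∷ endsIn12 (s<s z<s) ∷ []
  where
  endsIn12 : ∀ {x y z} → y < z → Avoids (k ∷ q) (x ∷ y ∷ z ∷ [])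
  endsIn12 y<z occ with _ , _ , _ , s , _ , order ← occurrence occ =
    no12 (drop-first s) (from (order (# 1) (# 2)) y<z)
    where
    drop-first : ∀ {a b c} → (a ∷ b ∷ c ∷ []) ⊆ k ∷ q → (b ∷ c ∷ []) ⊆ q
    drop-first (_ ∷ʳ s) = ∷ˡ⁻ s
    drop-first (_ ∷ s)  = s

avoidsΠ312⇒No12 : ∀ {k q} → k ∉ q → AvoidsAll (k ∷ q) Π312 → No12 q
avoidsΠ312⇒No12 {k} k∉q (av123 ∷ av213 ∷ av312 ∷ []) {a} {b} s a<b with <-cmp k a | <-cmp k b
... | tri< k<a _ _  | _             = av123 (contains123 (refl ∷ s) k<a a<b)
... | tri≈ _ refl _ | _             = k∉q (to∈ s)
... | tri> _ _ a<k  | tri< k<b _ _  = av213 (contains213 (refl ∷ s) a<k k<b)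
... | tri> _ _ _    | tri≈ _ refl _ = k∉q (to∈ (∷ˡ⁻ s))
... | tri> _ _ _    | tri> _ _ b<k  = av312 (contains312 (refl ∷ s) a<b b<k)

No12⇒avoidsΠ231 : ∀ {x} A {D} → All (x <_) (A ++ D) → No12 (A ++ D) → AvoidsAll (A ++ x ∷ D) Π231
No12⇒avoidsΠ231 {x} A {D} x<AD no12 = avoid123 ∷ avoid213 ∷ avoid231 ∷ []
  where
  x≤π : All (x ≤_) (A ++ x ∷ D)
  x≤π = All.++⁺ (All.map <⇒≤ (All.++⁻ˡ A x<AD)) (≤-refl ∷ All.map <⇒≤ (All.++⁻ʳ A x<AD))

  -- x is the least letter, so a 12 standing above some letter does not use x
  no12-above : ∀ {u v w} → (u ∷ v ∷ []) ⊆ A ++ x ∷ D → u < v → w ∈ A ++ x ∷ D → ¬ w < u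
  no12-above {u} s u<v w∈π w<u = no12 (⊆-remove A (>⇒≢ x<u ∷ >⇒≢ (<-trans x<u u<v) ∷ []) s) u<v
    where
    x<u : x < u
    x<u = ≤-<-trans (All.lookup x≤π w∈π) w<u

  avoid123 : Avoids (A ++ x ∷ D) p123
  avoid123 occ with _ , _ , _ , s , _ , order ← occurrence occ =
    no12-above (∷ˡ⁻ s) (from (order (# 1) (# 2)) (s<s (s<s z<s)))
      (to∈ s) (from (order (# 0) (# 1)) (s<s z<s))

  avoid213 : Avoids (A ++ x ∷ D) p213
  avoid213 occ with _ , b , _ , s , _ , order ← occurrence occ =
    no12-above (⊆-trans (refl ∷ b ∷ʳ ⊆-refl) s) (from (order (# 0) (# 2)) (s<s (s<s z<s)))
      (to∈ (∷ˡ⁻ s)) (from (order (# 1) (# 0)) (s<s z<s))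

  avoid231 : Avoids (A ++ x ∷ D) p231
  avoid231 occ with _ , _ , c , s , _ , order ← occurrence occ =
    no12-above (⊆-trans (refl ∷ refl ∷ c ∷ʳ []) s) (from (order (# 0) (# 1)) (s<s (s<s z<s)))
      (to∈ (∷ˡ⁻ (∷ˡ⁻ s))) (from (order (# 2) (# 0)) (s<s z<s))

avoidsΠ231⇒No12 : ∀ {x} A {D} → All (x <_) (A ++ D) → AvoidsAll (A ++ x ∷ D) Π231 → No12 (A ++ D)
avoidsΠ231⇒No12 {x} A x<AD (av123 ∷ av213 ∷ av231 ∷ []) s u<v
  with ⊆-insert x A s | All.lookup x<AD (to∈ s)
... | []              , _ , refl , s′ | x<u = av123 (contains123 s′ x<u u<v)
... | _ ∷ []          , _ , refl , s′ | x<u = av213 (contains213 s′ x<u u<v)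
... | _ ∷ _ ∷ []      , _ , refl , s′ | x<u = av231 (contains231 s′ u<v x<u)
... | _ ∷ _ ∷ _ ∷ _   , _ , ()   , _  | _

evensBelow : ℕ → List ℕ
evensBelow zero          = []
evensBelow (suc zero)    = 0 ∷ []
evensBelow (suc (suc n)) = 0 ∷ map (2 +_) (evensBelow n)

length-evensBelow : ∀ n → length (evensBelow n) ≡ ⌈ n /2⌉
length-evensBelow zero          = refl
length-evensBelow (suc zero)    = refl
length-evensBelow (suc (suc n)) = cong suc (trans (length-map (2 +_) (evensBelow n)) (length-evensBelow n))

evensBelow-unique : ∀ n → Unique (evensBelow n)
evensBelow-unique zero          = []
evensBelow-unique (suc zero)    = [] ∷ []
evensBelow-unique (suc (suc n)) =
  All.map⁺ (All.universal (λ _ ()) (evensBelow n)) ∷ Unique.map⁺ (+-cancelˡ-≡ 2 _ _) (evensBelow-unique n)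

∈-evensBelow⁺ : ∀ {n d} → Even d → d < n → d ∈ evensBelow n
∈-evensBelow⁺ {suc zero}    even-zero  _                 = here refl
∈-evensBelow⁺ {suc (suc n)} even-zero  _                 = here refl
∈-evensBelow⁺ {suc (suc n)} (even-ss e) (s≤s (s≤s d<n)) = there (∈-map⁺ (2 +_) (∈-evensBelow⁺ e d<n))
∈-evensBelow⁺ {suc zero}    (even-ss _) (s≤s ())

∈-evensBelow⁻ : ∀ n {d} → d ∈ evensBelow n → Even d × d < n
∈-evensBelow⁻ (suc zero)    (here refl) = even-zero , z<s
∈-evensBelow⁻ (suc (suc n)) (here refl) = even-zero , z<s
∈-evensBelow⁻ (suc (suc n)) (there d∈)
  with d , d∈′ , refl ← ∈-map⁻ (2 +_) d∈ =
  let e , d<n = ∈-evensBelow⁻ n d∈′ in even-ss e , s<s (s<s d<n)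

record AvoiderFamily (Π : List (List ℕ)) : Set where
  field
    word           : ℕ → ℕ → List ℕ
    word-perm      : ∀ m d → IsPerm (suc (m + d)) (word m d)
    word-avoids    : ∀ m d → AvoidsAll (word m d) Π
    word-Jacobi    : ∀ m d → Jacobi (word m d) ⇔ Even d
    word-injective : ∀ {m d m′ d′} → word m d ≡ word m′ d′ → d ≡ d′
    word-complete  : ∀ {n π} → n ≥ 1 → IsPerm n π → AvoidsAll π Π →
                     ∃₂ λ m d → n ≡ suc (m + d) × π ≡ word m d

JCount-family : ∀ {Π n} → AvoiderFamily Π → n ≥ 1 → JCount n Π ⌈ n /2⌉
JCount-family {Π} {n} family n≥1 =
  map F (evensBelow n) ,
  Unique.map⁺ word-injective (evensBelow-unique n) ,
  All.map⁺ (All.tabulate (F-counted ∘ ∈-evensBelow⁻ n)) ,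
  counted⇒∈ ,
  trans (length-map F (evensBelow n)) (length-evensBelow n)
  where
  open AvoiderFamily family

  F : ℕ → List ℕ
  F d = word (n ∸ suc d) d

  F-counted : ∀ {d} → Even d × d < n → JacobiAvoider n Π (F d)
  F-counted {d} (even , d<n) = subst (λ n′ → JacobiAvoider n′ Π (F d)) size
    (word-perm _ d , from (word-Jacobi _ d) even , word-avoids _ d)
    where
    size : suc (n ∸ suc d + d) ≡ n
    size = trans (sym (+-suc (n ∸ suc d) d)) (m∸n+n≡m d<n)

  counted⇒∈ : ∀ π → JacobiAvoider n Π π → π ∈ map F (evensBelow n)
  counted⇒∈ π (π↭ , jac , avoids) with m , d , n≡ , refl ← word-complete n≥1 π↭ avoids =
    subst (λ m′ → word m′ d ∈ map F (evensBelow n)) m≡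
      (∈-map⁺ F (∈-evensBelow⁺ (to (word-Jacobi m d) jac) d<n))
    where
    d<n : d < n
    d<n = subst (d <_) (sym n≡) (s≤s (m≤n+m d m))
    m≡ : n ∸ suc d ≡ m
    m≡ = trans (cong (_∸ suc d) n≡) (m+n∸n≡m m d)

perm312 : ℕ → ℕ → List ℕ
perm312 m d = suc m ∷ down (suc m) d ++ down 0 m

perm312-tail-nonincreasing : ∀ m d → AllPairs _≥_ (down (suc m) d ++ down 0 m)
perm312-tail-nonincreasing m d = AllPairs.++⁺ (down-nonincreasing (suc m) d) (down-nonincreasing 0 m)
  (All.map (λ m<x → All.map (λ y≤m → <⇒≤ (<-trans (s≤s y≤m) m<x)) (down-≤ 0 m)) (down-> (suc m) d))

perm312-↭ : ∀ m d → IsPerm (suc (m + d)) (perm312 m d)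
perm312-↭ m d = begin
  suc m ∷ down (suc m) d ++ down 0 m ↭⟨ shift (suc m) (down (suc m) d) (down 0 m) ⟨
  down (suc m) d ++ down 0 (suc m)   ≡⟨ down-++ 0 d (suc m) ⟩
  down 0 (d + suc m)                 ≡⟨ cong (down 0) (+-comm d (suc m)) ⟩
  down 0 (suc m + d)                 ↭⟨ range↭down (suc m + d) ⟨
  range (suc m + d)                  ∎
  where open PermutationReasoning

perm312-avoids : ∀ m d → AvoidsAll (perm312 m d) Π312
perm312-avoids m d = No12⇒avoidsΠ312 (nonincreasing⇒No12 (perm312-tail-nonincreasing m d))

rhoLen-perm312 : ∀ m d → rhoLen (suc m) (down (suc m) d ++ down 0 m) ≡ d
rhoLen-perm312 m d =
  trans (rhoLen-++ (down-> (suc m) d) (All.map m≤n⇒m≤1+n (down-≤ 0 m))) (length-down (suc m) d)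

Jacobi-perm312 : ∀ m d → Jacobi (perm312 m d) ⇔ Even d
Jacobi-perm312 m d = mk⇔
  (subst Even (rhoLen-perm312 m d) ∘ proj₁)
  (λ even → subst Even (sym (rhoLen-perm312 m d)) even , Jacobi-nonincreasing (perm312-tail-nonincreasing m d))

perm312-injective : ∀ {m d m′ d′} → perm312 m d ≡ perm312 m′ d′ → d ≡ d′
perm312-injective {m} {d} {m′} {d′} eq = begin
  d                               ≡⟨ rhoLen-perm312 m d ⟨
  rhoLen-first (perm312 m d)      ≡⟨ cong rhoLen-first eq ⟩
  rhoLen-first (perm312 m′ d′)    ≡⟨ rhoLen-perm312 m′ d′ ⟩
  d′                              ∎
  where
  open ≡-Reasoning
  rhoLen-first : List ℕ → ℕ
  rhoLen-first []       = 0
  rhoLen-first (x ∷ xs) = rhoLen x xs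

perm312-complete : ∀ {n π} → n ≥ 1 → IsPerm n π → AvoidsAll π Π312 →
  ∃₂ λ m d → n ≡ suc (m + d) × π ≡ perm312 m d
perm312-complete {π = []} n≥1 π↭ _ = contradiction (perm-∋1 π↭ n≥1) λ ()
perm312-complete {n} {k ∷ q} _ π↭ avoids with m , m<n , refl ← perm-letter π↭ (here refl) =
  m , d , n≡ , cong (suc m ∷_) q≡
  where
  d : ℕ
  d = n ∸ suc m

  n≡ : n ≡ suc (m + d)
  n≡ = sym (m+[n∸m]≡n m<n)

  q↭ : q ↭ down (suc m) d ++ down 0 m
  q↭ = drop-mid [] (down (suc m) d) (begin
    suc m ∷ q                          ↭⟨ π↭ ⟩
    range n                            ↭⟨ range↭down n ⟩
    down 0 n                           ≡⟨ cong (down 0) (trans n≡ (+-comm (suc m) d)) ⟩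
    down 0 (d + suc m)                 ≡⟨ down-++ 0 d (suc m) ⟨
    down (suc m) d ++ suc m ∷ down 0 m ∎)
    where open PermutationReasoning

  q≡ : q ≡ down (suc m) d ++ down 0 m
  q≡ = nonincreasing-↭⇒≡
    (No12⇒nonincreasing (avoidsΠ312⇒No12 (Unique[x∷xs]⇒x∉xs (perm-unique π↭)) avoids))
    (perm312-tail-nonincreasing m d) q↭

family312 : AvoiderFamily Π312
family312 = record
  { word           = perm312
  ; word-perm      = perm312-↭
  ; word-avoids    = perm312-avoids
  ; word-Jacobi    = Jacobi-perm312
  ; word-injective = perm312-injective
  ; word-complete  = perm312-complete
  }

perm231 : ℕ → ℕ → List ℕ
perm231 a d = down (suc d) a ++ 1 ∷ down 1 d

perm231-↭ : ∀ a d → IsPerm (suc (a + d)) (perm231 a d)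
perm231-↭ a d = begin
  down (suc d) a ++ 1 ∷ down 1 d        ↭⟨ shift 1 (down (suc d) a) (down 1 d) ⟩
  1 ∷ down (suc d) a ++ down 1 d        ↭⟨ ∷↭∷ʳ 1 (down (suc d) a ++ down 1 d) ⟩
  (down (suc d) a ++ down 1 d) ++ [ 1 ] ≡⟨ cong (_++ [ 1 ]) (down-++ 1 a d) ⟩
  down 1 (a + d) ++ [ 1 ]               ≡⟨ down-∷ʳ (a + d) ⟩
  down 0 (suc (a + d))                  ↭⟨ range↭down (suc (a + d)) ⟨
  range (suc (a + d))                   ∎
  where open PermutationReasoning

perm231-avoids : ∀ a d → AvoidsAll (perm231 a d) Π231
perm231-avoids a d = No12⇒avoidsΠ231 (down (suc d) a)
  (subst (All (1 <_)) rest≡ (down-> 1 (a + d)))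
  (subst No12 rest≡ (nonincreasing⇒No12 (down-nonincreasing 1 (a + d))))
  where
  rest≡ : down 1 (a + d) ≡ down (suc d) a ++ down 1 d
  rest≡ = sym (down-++ 1 a d)

1∉down : ∀ a d → 1 ∉ down (suc d) a
1∉down a d 1∈ = <⇒≱ (All.lookup (down-> (suc d) a) 1∈) (s≤s z≤n)

Jacobi-perm231 : ∀ a d → Jacobi (perm231 a d) ⇔ Even d
Jacobi-perm231 a d = mk⇔
  (subst Even ρ≡d ∘ proj₁ ∘ Jacobi-++⁻ʳ (down (suc d) a))
  (λ even → Jacobi-++⁺ (down-nonincreasing (suc d) a) (All.map (≤-trans (s≤s z≤n) ∘ <⇒≤) (down-> (suc d) a))
    (subst Even (sym ρ≡d) even , Jacobi-nonincreasing (down-nonincreasing 1 d)))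
  where
  ρ≡d : rhoLen 1 (down 1 d) ≡ d
  ρ≡d = trans (cong (rhoLen 1) (sym (++-identityʳ (down 1 d))))
    (trans (rhoLen-++ (down-> 1 d) []) (length-down 1 d))

perm231-injective : ∀ {a d a′ d′} → perm231 a d ≡ perm231 a′ d′ → d ≡ d′
perm231-injective {a} {d} {a′} {d′} eq = begin
  d                  ≡⟨ length-down 1 d ⟨
  length (down 1 d)  ≡⟨ cong length (++-∷-injectiveʳ (down (suc d) a) (down (suc d′) a′) (1∉down a d) (1∉down a′ d′) eq) ⟩
  length (down 1 d′) ≡⟨ length-down 1 d′ ⟩
  d′                 ∎
  where open ≡-Reasoning

perm231-complete : ∀ {n π} → n ≥ 1 → IsPerm n π → AvoidsAll π Π231 →
  ∃₂ λ a d → n ≡ suc (a + d) × π ≡ perm231 a d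
perm231-complete {suc n} n≥1 π↭ avoids with A , D , refl ← ∈-∃++ (perm-∋1 π↭ n≥1) =
  a , d , cong suc n≡ , cong₂ (λ A′ D′ → A′ ++ 1 ∷ D′) (proj₁ A≡×D≡) (proj₂ A≡×D≡)
  where
  open PermutationReasoning

  π↭′ : A ++ [ 1 ] ++ D ↭ down 1 n ++ [ 1 ] ++ []
  π↭′ = begin
    A ++ 1 ∷ D        ↭⟨ π↭ ⟩
    range (suc n)     ↭⟨ range↭down (suc n) ⟩
    down 0 (suc n)    ≡⟨ down-∷ʳ n ⟨
    down 1 n ++ [ 1 ] ∎

  AD↭ : A ++ D ↭ down 1 n
  AD↭ = begin
    A ++ D         ↭⟨ drop-mid A (down 1 n) π↭′ ⟩
    down 1 n ++ [] ≡⟨ ++-identityʳ (down 1 n) ⟩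
    down 1 n       ∎

  a d : ℕ
  a = length A
  d = length D

  n≡ : n ≡ a + d
  n≡ = trans (sym (length-down 1 n)) (trans (sym (↭-length AD↭)) (length-++ A))

  AD-nonincreasing : AllPairs _≥_ (A ++ D)
  AD-nonincreasing = No12⇒nonincreasing (avoidsΠ231⇒No12 A (All-resp-↭ (↭-sym AD↭) (down-> 1 n)) avoids)

  AD≡ : A ++ D ≡ down (suc d) a ++ down 1 d
  AD≡ = trans (nonincreasing-↭⇒≡ AD-nonincreasing (down-nonincreasing 1 n) AD↭)
    (trans (cong (down 1) n≡) (sym (down-++ 1 a d)))

  A≡×D≡ : A ≡ down (suc d) a × D ≡ down 1 d
  A≡×D≡ = ++-injective (sym (length-down (suc d) a)) AD≡

family231 : AvoiderFamily Π231
family231 = record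
  { word           = perm231
  ; word-perm      = perm231-↭
  ; word-avoids    = perm231-avoids
  ; word-Jacobi    = Jacobi-perm231
  ; word-injective = perm231-injective
  ; word-complete  = perm231-complete
  }

theorem8p8 : (n : ℕ) → n ≥ 1 → (σ : List ℕ) → σ ≡ p231 ⊎ σ ≡ p312 →
    JCount n (p123 ∷ p213 ∷ σ ∷ []) ⌈ n /2⌉
theorem8p8 n n≥1 σ (inj₁ refl) = JCount-family family231 n≥1
theorem8p8 n n≥1 σ (inj₂ refl) = JCount-family family312 n≥1
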